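{- For no constant $\varepsilon>0$ does there exist a $\left(\frac32-\varepsilon\right)$-competitive online algorithm for $1|jrp,s=1,p_j=1,r_j|\sum C_j+c_\mathcal{Q}$.
   Context: Problem $1|jrp,s=1,p_j=1,r_j|\sum C_j+c_\mathcal{Q}$: jobs with processing time $1$ and nonnegative integer release dates $r_j$ must be processed non-preemptively on a single machine (at most one job at a time). There is a single resource, required by every job; each replenishment of it costs $K:=K_0+K_1\ge0$ (part of the instance). A solution consists of start times $S_j$ (completion times $C_j=S_j+1$) and replenishment times $t_1<\dots<t_q$; it is feasible if no two jobs overlap and for each job $j$ some replenishment time lies in $[r_j,S_j]$. Its cost is $\sum_jC_j+qK$. Online setting: jobs are not known in advance (neither their number nor their data); a job becomes known at its release date, and replenishment and scheduling decisions cannot be revoked. An online algorithm is $c$-competitive if on every instance its cost is at most $c$ times the optimal offline cost.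
   Formalization: The start times and replenishment times, both of the online algorithms and of the solutions they are compared against, take values in the rationals, and the replenishment cost K is rational. -}

module Defs where

open import Data.Nat using (ℕ) renaming (_≤_ to _≤ℕ_)
open import Data.Integer using (+_)
open import Data.Rational using (ℚ; 0ℚ; 1ℚ; ½; _+_; _*_; _-_; _≤_; _<_; _/_)
open import Data.Rational.Properties using (_≤?_)
open import Data.List using (List; []; _∷_; length; map; filter; foldr; zip; upTo)
open import Data.List.Relation.Unary.Linked using (Linked)
open import Data.List.Relation.Unary.Any using (Any)
open import Data.List.Relation.Unary.All using (All)
open import Data.Product using (_×_; _,_; proj₁; proj₂; Σ)
open import Data.Sum using (_⊎_)
open import Data.Unit using (⊤)
open import Relation.Binary.PropositionalEquality using (_≡_; _≢_)

⟦_⟧ : ℕ → ℚ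
⟦ n ⟧ = (+ n) / 1

-- Jobs are listed in order of (nondecreasing) release dates; job j is the
-- j-th entry (position) of the list 'release'.  K = K₀ + K₁ ≥ 0 is the cost
-- of one replenishment of the single resource.
record Instance : Set where
  constructor mkInstance
  field
    K       : ℚ
    K≥0     : 0ℚ ≤ K
    release : List ℕ
    sorted  : Linked _≤ℕ_ release

open Instance public

-- A (candidate) solution: start times of the jobs (same order as the release
-- list) and replenishment times t₁ < … < t_q.
record Solution (I : Instance) : Set where
  constructor mkSolution
  field
    starts     : List ℚ
    lengthOK   : length starts ≡ length (release I)
    replenish  : List ℚ
    increasing : Linked _<_ replenish

open Solution public

jobs : {I : Instance} → Solution I → List (ℕ × ℚ)
jobs {I} s = zip (release I) (starts s)

NoOverlap : List ℚ → Set
NoOverlap []       = ⊤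
NoOverlap (s ∷ ss) = All (λ s' → (s + 1ℚ ≤ s') ⊎ (s' + 1ℚ ≤ s)) ss × NoOverlap ss

Feasible : {I : Instance} → Solution I → Set
Feasible {I} s =
  NoOverlap (starts s) ×
  All (λ rs → Any (λ t → (⟦ proj₁ rs ⟧ ≤ t) × (t ≤ proj₂ rs)) (replenish s)) (jobs s)

sumℚ : List ℚ → ℚ
sumℚ = foldr _+_ 0ℚ

cost : {I : Instance} → Solution I → ℚ
cost {I} s = sumℚ (map (λ S → S + 1ℚ) (starts s)) + ⟦ length (replenish s) ⟧ * K I

Algorithm : Set
Algorithm = (I : Instance) → Solution I

-- Information revealed up to time t: K and the jobs released by time t
-- (a prefix of the release list, as it is sorted).
releasedBy : ℚ → Instance → List ℕ
releasedBy t I = filter (λ r → ⟦ r ⟧ ≤? t) (release I)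

indexed : List ℚ → List (ℕ × ℚ)
indexed ss = zip (upTo (length ss)) ss

replenishedBy : ℚ → {I : Instance} → Solution I → List ℚ
replenishedBy t s = filter (λ x → x ≤? t) (replenish s)

startedBy : ℚ → {I : Instance} → Solution I → List (ℕ × ℚ)
startedBy t s = filter (λ p → proj₂ p ≤? t) (indexed (starts s))

record OnlineAlgorithm : Set where
  field
    alg        : Algorithm
    feasible   : (I : Instance) → Feasible (alg I)
    nonAnticipatory :
      (t : ℚ) (I I' : Instance) →
      K I ≡ K I' → releasedBy t I ≡ releasedBy t I' →
      (replenishedBy t (alg I) ≡ replenishedBy t (alg I')) ×
      (startedBy t (alg I) ≡ startedBy t (alg I'))

open OnlineAlgorithm public

-- c-competitive: on every instance, the cost is at most c times the optimal
-- offline cost, i.e. at most c times the cost of every feasible solution.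
Competitive : ℚ → OnlineAlgorithm → Set
Competitive c A =
  (I : Instance) (s : Solution I) → Feasible s → cost (alg A I) ≤ c * cost s

threeHalves : ℚ
threeHalves = (+ 3) / 2

{-# OPTIONS --safe #-}
-- Take K = 2m with εm ≥ 2 and release one job at time 0; the optimum costs 1 + 2m. If the
-- algorithm starts it at some S ≥ m, it pays at least 3m + 1. Otherwise release a second job
-- at r = ⌊S⌋ + 1 ≤ m: up to time S < r the algorithm cannot tell the two instances apart, so
-- it still starts the first job at S and must replenish again for the second one, paying at
-- least 2r + 1 + 4m, while a single replenishment at r serving both jobs costs 2r + 3 + 2m.
-- In both cases the ratio exceeds 3/2 − ε.
module Submission where

open import Defs
open import Level using (Level)
open import Data.Nat as ℕ using (ℕ; zero; suc; z≤n; s≤s)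
import Data.Nat.Properties as ℕ
import Data.Nat.Coprimality as Coprimality
open import Data.Integer as ℤ using (+_)
import Data.Integer.Properties as ℤ
import Data.Sign.Base as Sign
open import Data.Rational
  using (ℚ; 0ℚ; 1ℚ; ½; mkℚ; _+_; _-_; _*_; _/_; _≤_; _<_; *≤*; *<*; toℚᵘ; nonNegative)
open import Data.Rational.Properties
import Data.Rational.Unnormalised as ℚᵘ
import Data.Rational.Unnormalised.Properties as ℚᵘ
open import Data.Product using (Σ; ∃; _,_; _×_; proj₁; proj₂)
open import Data.Sum using (inj₁)
open import Data.Unit using (tt)
open import Data.Empty using (⊥)
open import Data.List using (List; []; _∷_; length; map; filter)
open import Data.List.Properties using (filter-accept; filter-reject)
open import Data.List.Relation.Unary.Any using (Any; here; there)
open import Data.List.Relation.Unary.All using ([]; _∷_)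
open import Data.List.Relation.Unary.Linked using ([-]; _∷_)
open import Data.List.Membership.Propositional using (_∈_)
open import Data.List.Membership.Propositional.Properties using (∈-filter⁺; ∈-filter⁻)
open import Relation.Nullary using (¬_; Dec; yes; no; contradiction)
open import Relation.Nullary.Decidable using (dec⇒maybe; toWitness)
open import Relation.Binary.PropositionalEquality
open import Tactic.RingSolver using (solve-∀)
open import Tactic.RingSolver.Core.AlmostCommutativeRing
  using (AlmostCommutativeRing; fromCommutativeRing)

⟦⟧≡mkℚ : ∀ n → ⟦ n ⟧ ≡ mkℚ (+ n) 0 (Coprimality.sym (Coprimality.1-coprimeTo n))
⟦⟧≡mkℚ n = normalize-coprime (Coprimality.sym (Coprimality.1-coprimeTo n))

⟦⟧-mono-≤ : ∀ {m n} → m ℕ.≤ n → ⟦ m ⟧ ≤ ⟦ n ⟧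
⟦⟧-mono-≤ {m} {n} m≤n rewrite ⟦⟧≡mkℚ m | ⟦⟧≡mkℚ n =
  *≤* (subst₂ ℤ._≤_ (sym (ℤ.*-identityʳ (+ m))) (sym (ℤ.*-identityʳ (+ n))) (ℤ.+≤+ m≤n))

0≤⟦⟧ : ∀ n → 0ℚ ≤ ⟦ n ⟧
0≤⟦⟧ n = ⟦⟧-mono-≤ {n = n} z≤n

⟦⟧-suc : ∀ n → ⟦ suc n ⟧ ≡ ⟦ n ⟧ + 1ℚ
⟦⟧-suc n = toℚᵘ-injective (ℚᵘ.≃-trans ⟦⟧-sucᵘ (ℚᵘ.≃-sym (toℚᵘ-homo-+ ⟦ n ⟧ 1ℚ)))
  where
  ⟦⟧-sucᵘ : toℚᵘ ⟦ suc n ⟧ ℚᵘ.≃ toℚᵘ ⟦ n ⟧ ℚᵘ.+ toℚᵘ 1ℚ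
  ⟦⟧-sucᵘ rewrite ⟦⟧≡mkℚ n | ⟦⟧≡mkℚ (suc n) = ℚᵘ.*≡* (cong (ℤ._* + 1) +suc≡++1)
    where
    +suc≡++1 : + suc n ≡ (Sign.+ ℤ.◃ (n ℕ.* 1)) ℤ.+ + 1
    +suc≡++1 rewrite ℕ.*-identityʳ n | ℤ.+◃n≡+n n = cong +_ (ℕ.+-comm 1 n)

archimedean : ∀ {ε} → 0ℚ < ε → ∀ n → ∃ λ M → ⟦ n ⟧ ≤ ε * ⟦ M ⟧
archimedean {mkℚ (+ zero) _ _} (*<* (ℤ.+<+ ()))
archimedean {mkℚ ℤ.-[1+ _ ] _ _} (*<* ())
-- ε ≥ 1/(d+1), so M = n(d+1) will do.
archimedean {ε@(mkℚ (+ suc p) d _)} _ n = n ℕ.* suc d , toℚᵘ-cancel-≤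
  (ℚᵘ.≤-respʳ-≃ (ℚᵘ.≃-sym (toℚᵘ-homo-* ε ⟦ n ℕ.* suc d ⟧)) boundᵘ)
  where
  boundᵘ : toℚᵘ ⟦ n ⟧ ℚᵘ.≤ toℚᵘ ε ℚᵘ.* toℚᵘ ⟦ n ℕ.* suc d ⟧
  boundᵘ rewrite ⟦⟧≡mkℚ n | ⟦⟧≡mkℚ (n ℕ.* suc d) = ℚᵘ.*≤* (subst₂ ℤ._≤_
    (ℤ.pos-* n (suc d ℕ.* 1))
    (trans (ℤ.pos-* (suc p) (n ℕ.* suc d)) (sym (ℤ.*-identityʳ _)))
    (ℤ.+≤+ (ℕ.≤-trans (ℕ.≤-reflexive (cong (n ℕ.*_) (ℕ.*-identityʳ (suc d))))
                      (ℕ.m≤m+n (n ℕ.* suc d) (p ℕ.* (n ℕ.* suc d))))))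

<⇒≱ : ∀ {p q} → p < q → ¬ q ≤ p
<⇒≱ p<q q≤p = <-irrefl refl (<-≤-trans p<q q≤p)

nat-floor : ∀ {S} N → 0ℚ ≤ S → S < ⟦ N ⟧ → ∃ λ k → k ℕ.< N × ⟦ k ⟧ ≤ S × S < ⟦ suc k ⟧
nat-floor zero    0≤S S<0 = contradiction 0≤S (<⇒≱ S<0)
nat-floor {S} (suc N) 0≤S S<N+1 with S <? ⟦ N ⟧
... | no  S≮N = N , ℕ.n<1+n N , ≮⇒≥ S≮N , S<N+1
... | yes S<N with nat-floor N 0≤S S<N
...   | k , k<N , k≤S , S<k+1 = k , ℕ.m<n⇒m<1+n k<N , k≤S , S<k+1

<-by-surplus : ∀ {x y z d} → x + y ≡ z + d → d < y → x < z
<-by-surplus {x} {y} {z} {d} x+y≡z+d d<y with z ≤? x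
... | no  z≰x = ≰⇒> z≰x
... | yes z≤x = contradiction (begin z + y ≤⟨ +-monoˡ-≤ y z≤x ⟩ x + y ≡⟨ x+y≡z+d ⟩ z + d ∎)
                              (<⇒≱ (+-monoʳ-< z d<y))
  where open ≤-Reasoning

ℚ-almostCommutativeRing : AlmostCommutativeRing _ _
ℚ-almostCommutativeRing = fromCommutativeRing +-*-commutativeRing (λ q → dec⇒maybe (0ℚ ≟ q))

0≤1 : 0ℚ ≤ 1ℚ
0≤1 = toWitness {a? = 0ℚ ≤? 1ℚ} tt

0≤p⇒0≤p+1 : ∀ {p} → 0ℚ ≤ p → 0ℚ ≤ p + 1ℚ
0≤p⇒0≤p+1 0≤p = +-mono-≤ 0≤p 0≤1

-- Both sides are written exactly as `cost` unfolds on the schedules of the adversary.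
module RatioBounds {ε m : ℚ} (0≤ε : 0ℚ ≤ ε) (2≤εm : ⟦ 2 ⟧ ≤ ε * m) where

  4≤ε*[u+2m] : ∀ {u} → 0ℚ ≤ u → ⟦ 4 ⟧ ≤ ε * (u + ⟦ 1 ⟧ * (m + m))
  4≤ε*[u+2m] {u} 0≤u = begin
    ⟦ 4 ⟧                      ≡⟨⟩
    0ℚ + (⟦ 2 ⟧ + ⟦ 2 ⟧)       ≤⟨ +-mono-≤ 0≤εu (+-mono-≤ 2≤εm 2≤εm) ⟩
    ε * u + (ε * m + ε * m)    ≡⟨ distrib ε u m ⟩
    ε * (u + ⟦ 1 ⟧ * (m + m))  ∎
    where
    open ≤-Reasoning
    0≤εu : 0ℚ ≤ ε * u
    0≤εu = ≤-trans (≤-reflexive (sym (*-zeroʳ ε))) (*-monoˡ-≤-nonNeg ε {{nonNegative 0≤ε}} 0≤u)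
    distrib : ∀ ε u m → ε * u + (ε * m + ε * m) ≡ ε * (u + ⟦ 1 ⟧ * (m + m))
    distrib = solve-∀ ℚ-almostCommutativeRing

  oneJob-ratio : (threeHalves - ε) * (((0ℚ + 1ℚ) + 0ℚ) + ⟦ 1 ⟧ * (m + m))
               < ((m + 1ℚ) + 0ℚ) + ⟦ 1 ⟧ * (m + m)
  oneJob-ratio = <-by-surplus (surplus ε m) (<-≤-trans ½<4 (4≤ε*[u+2m] 0≤1))
    where
    surplus : ∀ ε m →
      (threeHalves - ε) * (((0ℚ + 1ℚ) + 0ℚ) + ⟦ 1 ⟧ * (m + m))
        + ε * (((0ℚ + 1ℚ) + 0ℚ) + ⟦ 1 ⟧ * (m + m))
      ≡ (((m + 1ℚ) + 0ℚ) + ⟦ 1 ⟧ * (m + m)) + ½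
    surplus = solve-∀ ℚ-almostCommutativeRing
    ½<4 : ½ < ⟦ 4 ⟧
    ½<4 = toWitness {a? = ½ <? ⟦ 4 ⟧} tt

  twoJobs-ratio : ∀ {x} → 0ℚ ≤ x → x ≤ m →
    (threeHalves - ε) * (((x + 1ℚ) + (((x + 1ℚ) + 1ℚ) + 0ℚ)) + ⟦ 1 ⟧ * (m + m))
    < (x + ((x + 1ℚ) + 0ℚ)) + ⟦ 2 ⟧ * (m + m)
  twoJobs-ratio {x} 0≤x x≤m =
    <-by-surplus (surplus ε x m) (+-mono-<-≤ (<-≤-trans 7/2<4 (4≤ε*[u+2m] 0≤u)) x≤m)
    where
    surplus : ∀ ε x m →
      (threeHalves - ε) * (((x + 1ℚ) + (((x + 1ℚ) + 1ℚ) + 0ℚ)) + ⟦ 1 ⟧ * (m + m))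
        + (ε * (((x + 1ℚ) + (((x + 1ℚ) + 1ℚ) + 0ℚ)) + ⟦ 1 ⟧ * (m + m)) + m)
      ≡ ((x + ((x + 1ℚ) + 0ℚ)) + ⟦ 2 ⟧ * (m + m)) + ((+ 7) / 2 + x)
    surplus = solve-∀ ℚ-almostCommutativeRing
    7/2<4 : (+ 7) / 2 < ⟦ 4 ⟧
    7/2<4 = toWitness {a? = (+ 7) / 2 <? ⟦ 4 ⟧} tt
    0≤u : 0ℚ ≤ (x + 1ℚ) + (((x + 1ℚ) + 1ℚ) + 0ℚ)
    0≤u = +-mono-≤ (0≤p⇒0≤p+1 0≤x) (+-mono-≤ (0≤p⇒0≤p+1 (0≤p⇒0≤p+1 0≤x)) ≤-refl)

module _ {a p : Level} {A : Set a} {P : A → Set p} where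

  Any⇒1≤length : ∀ {xs} → Any P xs → 1 ℕ.≤ length xs
  Any⇒1≤length {_ ∷ _} _ = s≤s z≤n

  disjoint-Any⇒2≤length : ∀ {q} {Q : A → Set q} → (∀ {x} → P x → ¬ Q x) →
    ∀ {xs} → Any P xs → Any Q xs → 2 ℕ.≤ length xs
  disjoint-Any⇒2≤length P⇒¬Q {x ∷ []}    (here px) (here qx) = contradiction qx (P⇒¬Q px)
  disjoint-Any⇒2≤length P⇒¬Q {_ ∷ _ ∷ _} _         _         = s≤s (s≤s z≤n)

Any-between⇒≤ : ∀ {a b} {ts : List ℚ} → Any (λ t → a ≤ t × t ≤ b) ts → a ≤ b
Any-between⇒≤ (here (a≤t , t≤b)) = ≤-trans a≤t t≤b
Any-between⇒≤ (there between)   = Any-between⇒≤ between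

cost-lowerBound : ∀ {I} (s : Solution I) {q} → q ℕ.≤ length (replenish s) →
  sumℚ (map (λ S → S + 1ℚ) (starts s)) + ⟦ q ⟧ * K I ≤ cost s
cost-lowerBound {I} s q≤ = +-monoʳ-≤ (sumℚ (map (λ S → S + 1ℚ) (starts s)))
  (*-monoʳ-≤-nonNeg (K I) {{nonNegative (K≥0 I)}} (⟦⟧-mono-≤ q≤))

startedBy-first : ∀ {I} (s : Solution I) {S ss} → starts s ≡ S ∷ ss → (0 , S) ∈ startedBy S s
startedBy-first s refl = ∈-filter⁺ (λ job → proj₂ job ≤? _) (here refl) ≤-refl

startedBy-first⁻¹ : ∀ {I} (s : Solution I) {S₀ S₁ S t} → starts s ≡ S₀ ∷ S₁ ∷ [] →
  (0 , S) ∈ startedBy t s → S₀ ≡ S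
startedBy-first⁻¹ s {S₀} {S₁} {t = t} refl started
  with proj₁ (∈-filter⁻ (λ job → proj₂ job ≤? t) {xs = (0 , S₀) ∷ (1 , S₁) ∷ []} started)
... | here refl = refl
... | there (here ())

module Instances (K : ℚ) (0≤K : 0ℚ ≤ K) where

  oneJob : Instance
  oneJob = mkInstance K 0≤K (0 ∷ []) [-]

  twoJobs : ℕ → Instance
  twoJobs r = mkInstance K 0≤K (0 ∷ r ∷ []) (z≤n ∷ [-])

  serveAt0 : Solution oneJob
  serveAt0 = mkSolution (0ℚ ∷ []) refl (0ℚ ∷ []) [-]

  serveAt0-feasible : Feasible serveAt0
  serveAt0-feasible = ([] , tt) , (here (≤-refl , ≤-refl) ∷ [])

  serveBothAt : (r : ℕ) → Solution (twoJobs r)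
  serveBothAt r = mkSolution (⟦ r ⟧ ∷ (⟦ r ⟧ + 1ℚ) ∷ []) refl (⟦ r ⟧ ∷ []) [-]

  serveBothAt-feasible : ∀ r → Feasible (serveBothAt r)
  serveBothAt-feasible r =
    ((inj₁ ≤-refl ∷ []) , ([] , tt)) ,
    (here (0≤⟦⟧ r , ≤-refl) ∷ here (≤-refl , p≤p+1) ∷ [])
    where
    p≤p+1 : ⟦ r ⟧ ≤ ⟦ r ⟧ + 1ℚ
    p≤p+1 = subst (_≤ ⟦ r ⟧ + 1ℚ) (+-identityʳ ⟦ r ⟧) (+-monoʳ-≤ ⟦ r ⟧ 0≤1)

  releasedBy-oneJob≡twoJobs : ∀ {S r} → 0ℚ ≤ S → S < ⟦ r ⟧ →
    releasedBy S oneJob ≡ releasedBy S (twoJobs r)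
  releasedBy-oneJob≡twoJobs {S} {r} 0≤S S<r = begin
    filter⁺ (0 ∷ [])      ≡⟨ filter-accept released? {xs = []} 0≤S ⟩
    0 ∷ filter⁺ []        ≡⟨ cong (0 ∷_) (filter-reject released? {x = r} {xs = []} (<⇒≱ S<r)) ⟨
    0 ∷ filter⁺ (r ∷ [])  ≡⟨ filter-accept released? {xs = r ∷ []} 0≤S ⟨
    filter⁺ (0 ∷ r ∷ [])  ∎
    where
    open ≡-Reasoning
    released? = λ (x : ℕ) → ⟦ x ⟧ ≤? S
    filter⁺ = filter released?

  oneJob-lowerBound : (s : Solution oneJob) → Feasible s →
    ∃ λ S → starts s ≡ S ∷ [] × 0ℚ ≤ S × ((S + 1ℚ) + 0ℚ) + ⟦ 1 ⟧ * K ≤ cost s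
  oneJob-lowerBound s@(mkSolution (S ∷ []) refl _ _) (_ , served ∷ []) =
    S , refl , Any-between⇒≤ served , cost-lowerBound s (Any⇒1≤length served)

  twoJobs-lowerBound : ∀ {r S} → S < ⟦ r ⟧ → (s : Solution (twoJobs r)) → Feasible s →
    (0 , S) ∈ startedBy S s → ((S + 1ℚ) + ((⟦ r ⟧ + 1ℚ) + 0ℚ)) + ⟦ 2 ⟧ * K ≤ cost s
  twoJobs-lowerBound {r} {S} S<r s@(mkSolution (S₀ ∷ S₁ ∷ []) refl _ _)
                     (_ , served₀ ∷ served₁ ∷ []) started
    with startedBy-first⁻¹ s refl started
  ... | refl = ≤-trans
    (+-monoˡ-≤ (⟦ 2 ⟧ * K) (+-monoʳ-≤ (S + 1ℚ) (+-monoˡ-≤ 0ℚ (+-monoˡ-≤ 1ℚ r≤S₁))))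
    (cost-lowerBound s (disjoint-Any⇒2≤length before-r served₀ served₁))
    where
    r≤S₁ : ⟦ r ⟧ ≤ S₁
    r≤S₁ = Any-between⇒≤ served₁
    before-r : ∀ {t} → ⟦ 0 ⟧ ≤ t × t ≤ S → ¬ (⟦ r ⟧ ≤ t × t ≤ S₁)
    before-r (_ , t≤S) (r≤t , _) = <⇒≱ S<r (≤-trans r≤t t≤S)

module Adversary {ε} (ε>0 : 0ℚ < ε) (A : OnlineAlgorithm)
                 (competitive : Competitive (threeHalves - ε) A) where

  M : ℕ
  M = proj₁ (archimedean ε>0 2)

  m : ℚ
  m = ⟦ M ⟧

  open RatioBounds (<⇒≤ ε>0) (proj₂ (archimedean ε>0 2))
  open Instances (m + m) (+-mono-≤ (0≤⟦⟧ M) (0≤⟦⟧ M))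
  open ≤-Reasoning

  lateStart-impossible : ∀ {S} → m ≤ S →
    ((S + 1ℚ) + 0ℚ) + ⟦ 1 ⟧ * (m + m) ≤ cost (alg A oneJob) → ⊥
  lateStart-impossible {S} m≤S bound = <⇒≱ oneJob-ratio (begin
    ((m + 1ℚ) + 0ℚ) + ⟦ 1 ⟧ * (m + m)
      ≤⟨ +-monoˡ-≤ (⟦ 1 ⟧ * (m + m)) (+-monoˡ-≤ 0ℚ (+-monoˡ-≤ 1ℚ m≤S)) ⟩
    ((S + 1ℚ) + 0ℚ) + ⟦ 1 ⟧ * (m + m)
      ≤⟨ bound ⟩
    cost (alg A oneJob)
      ≤⟨ competitive oneJob serveAt0 serveAt0-feasible ⟩
    (threeHalves - ε) * cost serveAt0 ∎)

  earlyStart-impossible : ∀ {S} → starts (alg A oneJob) ≡ S ∷ [] → 0ℚ ≤ S →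
    (∃ λ k → k ℕ.< M × ⟦ k ⟧ ≤ S × S < ⟦ suc k ⟧) → ⊥
  earlyStart-impossible {S} starts≡ 0≤S (k , k<M , k≤S , S<r) =
    <⇒≱ (twoJobs-ratio (0≤⟦⟧ r) (⟦⟧-mono-≤ k<M)) (begin
      (⟦ r ⟧ + ((⟦ r ⟧ + 1ℚ) + 0ℚ)) + ⟦ 2 ⟧ * (m + m)
        ≤⟨ +-monoˡ-≤ (⟦ 2 ⟧ * (m + m)) (+-monoˡ-≤ ((⟦ r ⟧ + 1ℚ) + 0ℚ) r≤S+1) ⟩
      ((S + 1ℚ) + ((⟦ r ⟧ + 1ℚ) + 0ℚ)) + ⟦ 2 ⟧ * (m + m)
        ≤⟨ twoJobs-lowerBound S<r (alg A (twoJobs r)) (feasible A (twoJobs r)) started ⟩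
      cost (alg A (twoJobs r))
        ≤⟨ competitive (twoJobs r) (serveBothAt r) (serveBothAt-feasible r) ⟩
      (threeHalves - ε) * cost (serveBothAt r) ∎)
    where
    r = suc k
    r≤S+1 : ⟦ r ⟧ ≤ S + 1ℚ
    r≤S+1 = subst (_≤ S + 1ℚ) (sym (⟦⟧-suc k)) (+-monoˡ-≤ 1ℚ k≤S)
    started : (0 , S) ∈ startedBy S (alg A (twoJobs r))
    started = subst ((0 , S) ∈_)
      (proj₂ (nonAnticipatory A S oneJob (twoJobs r) refl (releasedBy-oneJob≡twoJobs 0≤S S<r)))
      (startedBy-first (alg A oneJob) starts≡)

  start-impossible : ∀ {S} → starts (alg A oneJob) ≡ S ∷ [] → 0ℚ ≤ S →
    ((S + 1ℚ) + 0ℚ) + ⟦ 1 ⟧ * (m + m) ≤ cost (alg A oneJob) → Dec (m ≤ S) → ⊥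
  start-impossible _       _   bound (yes m≤S) = lateStart-impossible m≤S bound
  start-impossible starts≡ 0≤S _     (no m≰S)  =
    earlyStart-impossible starts≡ 0≤S (nat-floor M 0≤S (≰⇒> m≰S))

  impossible : ⊥
  impossible =
    let S , starts≡ , 0≤S , bound = oneJob-lowerBound (alg A oneJob) (feasible A oneJob)
    in start-impossible starts≡ 0≤S bound (m ≤? S)

theorem11 : (ε : ℚ) → 0ℚ < ε →
    ¬ (Σ OnlineAlgorithm (λ A → Competitive (threeHalves - ε) A))
theorem11 ε ε>0 (A , competitive) = Adversary.impossible ε>0 A competitive
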